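{- Every directed tree admits an upward-leftward planar L-drawing. However, there exists a directed tree with a fixed bimodal planar embedding that admits no upward-planar L-drawing respecting that embedding.
   Context: In an L-drawing of a digraph, vertices are points and each edge $e$ is drawn as a polyline consisting of a vertical segment incident to the tail of $e$ and a horizontal segment incident to the head of $e$. It is planar if distinct edges may overlap but do not cross; upward if for every edge the lowest endpoint of its vertical segment is its tail; upward-leftward if it is upward and every edge points to the left (the head lies to the left of the tail). A planar embedding is bimodal if at every vertex the incoming edges are consecutive in the cyclic order of incident edges. -}

module Defs where

open import Data.Nat as ℕ using (ℕ; zero; suc; _+_)
open import Data.Integer as ℤ using (ℤ; -_)
open import Data.Integer.Properties using (_<?_)
open import Data.Fin using (Fin; _≟_)
open import Data.Bool using (Bool; true; false; if_then_else_)
open import Data.Product using (Σ; ∃; ∃-syntax; _×_; _,_)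
open import Data.Sum using (_⊎_)
open import Data.List using (List; _++_; map)
open import Data.List.Membership.Propositional using (_∈_)
open import Data.List.Relation.Unary.All using (All)
open import Data.List.Relation.Unary.Unique.Propositional using (Unique)
open import Data.List.Relation.Unary.Linked using (Linked)
open import Relation.Binary.PropositionalEquality using (_≡_)
open import Relation.Binary.Construct.Closure.ReflexiveTransitive using (Star)
open import Relation.Nullary using (¬_)
open import Relation.Nullary.Decidable using (⌊_⌋)
open import Function.Definitions using (Injective)
open import Function.Bundles using (_⇔_)

record Digraph : Set where
  field
    n    : ℕ
    m    : ℕ
    tail : Fin m → Fin n
    head : Fin m → Fin n
open Digraph public

Adj : (G : Digraph) → Fin (n G) → Fin (n G) → Set
Adj G u v = ∃[ e ] ((tail G e ≡ u × head G e ≡ v) ⊎ (tail G e ≡ v × head G e ≡ u))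

Connected : Digraph → Set
Connected G = ∀ u v → Star (Adj G) u v

IsDirectedTree : Digraph → Set
IsDirectedTree G = Connected G × m G + 1 ≡ n G

-- Edge e = (u,v) is
-- the vertical segment (x u, y u)–(x u, y v) followed by the horizontal
-- segment (x u, y v)–(x v, y v).

record LDrawing (G : Digraph) : Set where
  field
    x     : Fin (n G) → ℤ
    y     : Fin (n G) → ℤ
    x-inj : Injective _≡_ _≡_ x
    y-inj : Injective _≡_ _≡_ y
open LDrawing public

module _ {G : Digraph} (D : LDrawing G) where

  Upward : Set
  Upward = ∀ e → y D (tail G e) ℤ.< y D (head G e)

  Leftward : Set
  Leftward = ∀ e → x D (head G e) ℤ.< x D (tail G e)

  StrictlyBetween : ℤ → ℤ → ℤ → Set
  StrictlyBetween a b c = (b ℤ.< a × a ℤ.< c) ⊎ (c ℤ.< a × a ℤ.< b)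

  -- the vertical segment of e and the horizontal segment of f cross, i.e.
  -- meet in a point interior to both of them.  (Since coordinates are
  -- distinct, this is the only way two edges can cross; all other common
  -- points are overlaps of edges sharing the tail / sharing the head, or
  -- common endpoints.)
  Crosses : Fin (m G) → Fin (m G) → Set
  Crosses e f =
    StrictlyBetween (x D (tail G e)) (x D (tail G f)) (x D (head G f)) ×
    StrictlyBetween (y D (head G f)) (y D (tail G e)) (y D (head G e))

  Planar : Set
  Planar = ∀ e f → ¬ Crosses e f

-- Planar embeddings of a tree: a rotation system, i.e. for every vertex the
-- clockwise cyclic order (given by a list, read cyclically) of its incident
-- edges.  Every rotation system of a tree is a planar embedding.

Incident : (G : Digraph) → Fin (n G) → Fin (m G) → Set
Incident G v e = tail G e ≡ v ⊎ head G e ≡ v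

Rotation : Digraph → Set
Rotation G = Fin (n G) → List (Fin (m G))

IsEmbedding : (G : Digraph) → Rotation G → Set
IsEmbedding G rot = ∀ v → Unique (rot v) × (∀ e → (e ∈ rot v) ⇔ Incident G v e)

CyclicShift : {A : Set} → List A → List A → Set
CyclicShift {A} l l' = Σ (List A) λ p → Σ (List A) λ q → l ≡ p ++ q × l' ≡ q ++ p

IsBimodal : (G : Digraph) → Rotation G → Set
IsBimodal G rot = ∀ v → Σ (List (Fin (m G))) λ ins → Σ (List (Fin (m G))) λ outs →
  CyclicShift (rot v) (ins ++ outs) ×
  All (λ e → head G e ≡ v) ins × All (λ e → tail G e ≡ v) outs

-- Each edge end gets a key; keys are compared lexicographically and the
-- clockwise order (starting at the north-west) is the increasing order of keys.
--   port 0 : outgoing edges leaving upwards (north),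
--   port 1 : incoming edges arriving from the right (east),
--   port 2 : outgoing edges leaving downwards (south),
--   port 3 : incoming edges arriving from the left (west).
-- Inside a port, overlapping edges are ordered in the unique planar way.

record Key : Set where
  constructor key
  field
    port : ℕ
    sub  : ℕ
    val  : ℤ

data _<K_ : Key → Key → Set where
  port< : ∀ {p p' s s' z z'} → p ℕ.< p' → key p s z <K key p' s' z'
  sub<  : ∀ {p s s' z z'} → s ℕ.< s' → key p s z <K key p s' z'
  val<  : ∀ {p s z z'} → z ℤ.< z' → key p s z <K key p s z'

outKey : ℤ → ℤ → ℤ → ℤ → Key
outKey xv yv xw yw =
  if ⌊ yv <? yw ⌋
  then (if ⌊ xw <? xv ⌋ then key 0 0 yw else key 0 1 (- yw))
  else (if ⌊ xv <? xw ⌋ then key 2 0 (- yw) else key 2 1 yw)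

inKey : ℤ → ℤ → ℤ → ℤ → Key
inKey xv yv xu yu =
  if ⌊ xv <? xu ⌋
  then (if ⌊ yv <? yu ⌋ then key 1 0 xu else key 1 1 (- xu))
  else (if ⌊ yu <? yv ⌋ then key 3 0 (- xu) else key 3 1 xu)

keyAt : {G : Digraph} → LDrawing G → Fin (n G) → Fin (m G) → Key
keyAt {G} D v e =
  if ⌊ tail G e ≟ v ⌋
  then outKey (x D v) (y D v) (x D (head G e)) (y D (head G e))
  else inKey (x D v) (y D v) (x D (tail G e)) (y D (tail G e))

Respects : {G : Digraph} → LDrawing G → Rotation G → Set
Respects {G} D rot = ∀ v → Σ (List (Fin (m G))) λ l →
  CyclicShift (rot v) l × Linked _<K_ (map (keyAt D v) l)

{-# OPTIONS --safe #-}
-- An injective numbering of the vertices of a tree in which every edge ascends and no two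
-- edges interleave (rank (tail f) < rank (tail e) < rank (head f) < rank (head e)) is grown
-- from a single vertex by attaching the edges one at a time: the new leaf is ranked
-- immediately above or below its neighbour, so its edge spans no other vertex.  Placing the
-- vertex of rank p at (-p, p) gives an upward-leftward L-drawing, in which the vertical
-- segment of e crosses the horizontal segment of f exactly when e and f interleave.
--
-- For the counterexample, in an upward drawing the key of an incoming edge never precedes
-- that of an outgoing one, so the rotations at u, v, w force uv before uw at u, av before uv
-- at v and uw before cw at w.  If v lies left of u, then a lies right of u, so w lies below v
-- (else uw crosses av) and right of u; if v lies right of u, the order at u again puts w right
-- of u and below v.  Either way c lies left of u and cw crosses uv.
module Submission where

open import Defs
open import Data.Bool using (true; false)
open import Data.Empty using (⊥; ⊥-elim)
open import Data.Fin as F using (Fin; _≟_)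
import Data.Fin.Properties as FP
open import Data.Integer using (ℤ; +_; -_; +<+)
import Data.Integer.Properties as ℤP
open import Data.List using (List; []; _∷_; [_]; length; lookup; map)
open import Data.List.Membership.Propositional using (_∈_; _∉_)
open import Data.List.Membership.Propositional.Properties using (∈-lookup)
import Data.List.Membership.DecPropositional as DecMembership
open import Data.List.Relation.Unary.All as All using ([]; _∷_)
open import Data.List.Relation.Unary.All.Properties using (¬Any⇒All¬)
open import Data.List.Relation.Unary.AllPairs using ([]; _∷_)
open import Data.List.Relation.Unary.Any as Any using (here; there)
open import Data.List.Relation.Unary.Any.Properties using (lookup-index)
open import Data.List.Relation.Unary.Linked using (Linked; _∷_)
open import Data.List.Relation.Unary.Unique.Propositional using (Unique)
import Data.List.Relation.Unary.Unique.DecPropositional as DecUnique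
open import Data.Nat using (ℕ; zero; suc; _*_; _%_; s≤s; s≤s⁻¹)
open import Data.Nat.DivMod using (m*n%n≡0; [m+kn]%n≡m%n)
import Data.Nat.Properties as ℕP
open import Data.Product using (Σ; ∃; ∃₂; _×_; _,_; proj₁; proj₂)
open import Data.Sum using (_⊎_; inj₁; inj₂; [_,_])
open import Function.Base using (_∘_; _$_)
open import Function.Bundles using (_⇔_; mk⇔; Equivalence)
open import Function.Definitions using (Injective)
open import Relation.Binary.Core using (Rel)
open import Relation.Binary.Construct.Closure.ReflexiveTransitive as Star using (Star; ε; _◅_; _◅◅_)
open import Relation.Binary.PropositionalEquality
  using (_≡_; _≢_; refl; sym; trans; cong; subst; subst₂; ≢-sym; module ≡-Reasoning)
open import Relation.Nullary using (¬_; yes; no; contradiction)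
open import Relation.Nullary.Decidable
  using (Dec; ⌊_⌋; isYes≗does; dec-true; dec-false; toWitness; map′; _×-dec_; _⊎-dec_; _→-dec_)
open import Relation.Unary using (Pred; Decidable)

module UpwardLeftward where

  open import Data.Nat using (_≤_; _<_)
  open import Data.Integer using () renaming (_<_ to _<ℤ_)

  module _ {k : ℕ} where

    open DecMembership (_≟_ {k}) using (_∈?_)

    unique⇒lookup≢ : ∀ {xs : List (Fin k)} → Unique xs → ∀ {i j} → i F.< j → lookup xs i ≢ lookup xs j
    unique⇒lookup≢ (x∉xs ∷ _) {F.zero} {F.suc j} _ = All.lookup x∉xs (∈-lookup j)
    unique⇒lookup≢ (_ ∷ u) {F.suc i} {F.suc j} (s≤s i<j) = unique⇒lookup≢ u i<j

    unique⇒length≤ : (xs : List (Fin k)) → Unique xs → length xs ≤ k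
    unique⇒length≤ xs u with length xs ℕP.≤? k
    ... | yes ≤k = ≤k
    ... | no ≰k with i , j , i<j , eq ← FP.pigeonhole (ℕP.≰⇒> ≰k) (lookup xs) =
      contradiction eq (unique⇒lookup≢ u i<j)

    covering⇒length≥ : (xs : List (Fin k)) → (∀ z → z ∈ xs) → k ≤ length xs
    covering⇒length≥ xs covers with k ℕP.≤? length xs
    ... | yes ≤len = ≤len
    ... | no ≰len with i , j , i<j , eq ← FP.pigeonhole (ℕP.≰⇒> ≰len) (λ z → Any.index (covers z)) =
      contradiction i≡j (FP.<⇒≢ i<j)
      where
      open ≡-Reasoning
      i≡j : i ≡ j
      i≡j = begin
        i                                 ≡⟨ lookup-index (covers i) ⟩
        lookup xs (Any.index (covers i))  ≡⟨ cong (lookup xs) eq ⟩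
        lookup xs (Any.index (covers j))  ≡⟨ lookup-index (covers j) ⟨
        j                                 ∎

    unique∧length≡⇒covering : (xs : List (Fin k)) → Unique xs → length xs ≡ k → ∀ z → z ∈ xs
    unique∧length≡⇒covering xs u len z with z ∈? xs
    ... | yes z∈xs = z∈xs
    ... | no z∉xs = contradiction len (ℕP.<⇒≢ (unique⇒length≤ (z ∷ xs) (¬Any⇒All¬ xs z∉xs ∷ u)))

    length<⇒∃∉ : (xs : List (Fin k)) → length xs < k → ∃ λ z → z ∉ xs
    length<⇒∃∉ xs short =
      FP.¬∀⟶∃¬ k (_∈ xs) (_∈? xs) (λ covers → ℕP.<⇒≱ short (covering⇒length≥ xs covers))

  Star-exit : ∀ {a r p} {A : Set a} {R : Rel A r} {P : Pred A p} → Decidable P →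
              ∀ {s t} → Star R s t → P s → ¬ P t → ∃₂ λ u v → R u v × P u × ¬ P v
  Star-exit P? ε Ps ¬Pt = contradiction Ps ¬Pt
  Star-exit P? (_◅_ {j = v} r path) Pu ¬Pt with P? v
  ... | yes Pv = Star-exit P? path Pv ¬Pt
  ... | no ¬Pv = _ , _ , r , Pu , ¬Pv

  even≢odd : ∀ a b → a * 2 ≢ suc (b * 2)
  even≢odd a b eq = ℕP.0≢1+n (begin
    0                ≡⟨ m*n%n≡0 a 2 ⟨
    a * 2 % 2        ≡⟨ cong (_% 2) eq ⟩
    suc (b * 2) % 2  ≡⟨ [m+kn]%n≡m%n 1 b 2 ⟩
    1                ∎)
    where open ≡-Reasoning

  Interleaved : (G : Digraph) → (Fin (n G) → ℕ) → Fin (m G) → Fin (m G) → Set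
  Interleaved G rank e f =
    rank (tail G f) < rank (tail G e) × rank (tail G e) < rank (head G f) ×
    rank (head G f) < rank (head G e)

  record NonCrossingNumbering (G : Digraph) : Set where
    field
      rank           : Fin (n G) → ℕ
      rank-injective : Injective _≡_ _≡_ rank
      ascending      : ∀ e → rank (tail G e) < rank (head G e)
      non-crossing   : ∀ e f → ¬ Interleaved G rank e f

  drop‿-+<-+ : ∀ {a b} → - (+ a) <ℤ - (+ b) → b < a
  drop‿-+<-+ = ℤP.drop‿+<+ ∘ ℤP.neg-cancel-<

  module _ {G : Digraph} (N : NonCrossingNumbering G) where
    open NonCrossingNumbering N

    diagonal : LDrawing G
    diagonal = record
      { x     = λ v → - (+ rank v)
      ; y     = λ v → + rank v
      ; x-inj = rank-injective ∘ ℤP.+-injective ∘ ℤP.neg-injective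
      ; y-inj = rank-injective ∘ ℤP.+-injective
      }

    diagonal-upward : Upward diagonal
    diagonal-upward e = +<+ (ascending e)

    diagonal-leftward : Leftward diagonal
    diagonal-leftward e = ℤP.neg-mono-< (+<+ (ascending e))

    diagonal-planar : Planar diagonal
    diagonal-planar e f (_ , inj₂ (he<hf , hf<te)) =
      ℕP.<-asym (ascending e) (ℕP.<-trans (ℤP.drop‿+<+ he<hf) (ℤP.drop‿+<+ hf<te))
    diagonal-planar e f (inj₁ (tf<te , te<hf) , inj₁ _) =
      ℕP.<-asym (ascending f) (ℕP.<-trans (drop‿-+<-+ te<hf) (drop‿-+<-+ tf<te))
    diagonal-planar e f (inj₂ (hf<te , te<tf) , inj₁ (_ , hf<he)) =
      non-crossing e f (drop‿-+<-+ te<tf , drop‿-+<-+ hf<te , ℤP.drop‿+<+ hf<he)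

  -- Old ranks become odd and keep their order; the new vertex gets the even rank r * 2, which
  -- for r = rank u or r = suc (rank u) lies just below or just above the new rank of u.
  insertRank : ∀ {k} → (Fin k → ℕ) → Fin k → ℕ → Fin k → ℕ
  insertRank rank v r x with x ≟ v
  ... | yes _ = r * 2
  ... | no _  = suc (rank x * 2)

  insertRank-new : ∀ {k} (rank : Fin k → ℕ) v r → insertRank rank v r v ≡ r * 2
  insertRank-new rank v r with v ≟ v
  ... | yes _  = refl
  ... | no v≢v = contradiction refl v≢v

  insertRank-old : ∀ {k} (rank : Fin k → ℕ) {v} r {x} → x ≢ v → insertRank rank v r x ≡ suc (rank x * 2)
  insertRank-old rank {v} r {x} x≢v with x ≟ v
  ... | yes x≡v = contradiction x≡v x≢v
  ... | no _    = refl

  module TreeNumbering (G : Digraph) (tree : IsDirectedTree G) where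
    private
      V = Fin (n G)
      E = Fin (m G)
    open DecMembership (_≟_ {n G}) using (_∈?_)

    suc-m≡n : suc (m G) ≡ n G
    suc-m≡n = trans (ℕP.+-comm 1 (m G)) (proj₂ tree)

    root : V
    root = subst Fin suc-m≡n F.zero

    record Subtree (j : ℕ) : Set where
      field
        vertices        : List V
        edges           : List E
        rank            : V → ℕ
        root∈           : root ∈ vertices
        vertices-unique : Unique vertices
        edges-unique    : Unique edges
        vertices-length : length vertices ≡ suc j
        edges-length    : length edges ≡ j
        endpoints∈      : ∀ {e} → e ∈ edges → tail G e ∈ vertices × head G e ∈ vertices
        ascending       : ∀ {e} → e ∈ edges → rank (tail G e) < rank (head G e)
        non-crossing    : ∀ {e f} → e ∈ edges → f ∈ edges → ¬ Interleaved G rank e f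
        rank-injective  : ∀ {x y} → x ∈ vertices → y ∈ vertices → rank x ≡ rank y → x ≡ y

    single : Subtree 0
    single = record
      { vertices = [ root ] ; edges = [] ; rank = λ _ → 0 ; root∈ = here refl
      ; vertices-unique = [] ∷ [] ; edges-unique = [] ; vertices-length = refl ; edges-length = refl
      ; endpoints∈ = λ () ; ascending = λ () ; non-crossing = λ ()
      ; rank-injective = λ { (here refl) (here refl) _ → refl }
      }

    module Attach {j} (S : Subtree j) (e : E) (v : V) (v∉ : v ∉ Subtree.vertices S) (r : ℕ) where
      open Subtree S

      rank′ : V → ℕ
      rank′ = insertRank rank v r

      rank′-old : ∀ {x} → x ∈ vertices → rank′ x ≡ suc (rank x * 2)
      rank′-old x∈ = insertRank-old rank r λ { refl → v∉ x∈ }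

      rank′-mono : ∀ {x y} → x ∈ vertices → y ∈ vertices → rank x < rank y → rank′ x < rank′ y
      rank′-mono x∈ y∈ x<y rewrite rank′-old x∈ | rank′-old y∈ = s≤s (ℕP.*-monoˡ-< 2 x<y)

      rank′-cancel : ∀ {x y} → x ∈ vertices → y ∈ vertices → rank′ x < rank′ y → rank x < rank y
      rank′-cancel x∈ y∈ x<y rewrite rank′-old x∈ | rank′-old y∈ = ℕP.*-cancelʳ-< 2 _ _ (s≤s⁻¹ x<y)

      rank′-injective : ∀ {x y} → x ∈ v ∷ vertices → y ∈ v ∷ vertices → rank′ x ≡ rank′ y → x ≡ y
      rank′-injective (here refl) (here refl) _ = refl
      rank′-injective {y = y} (here refl) (there y∈) eq =
        ⊥-elim $ even≢odd r (rank y) $ trans (sym (insertRank-new rank v r)) (trans eq (rank′-old y∈))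
      rank′-injective {x} (there x∈) (here refl) eq =
        ⊥-elim $ even≢odd r (rank x) $ trans (sym (insertRank-new rank v r)) (trans (sym eq) (rank′-old x∈))
      rank′-injective {x} {y} (there x∈) (there y∈) eq =
        rank-injective x∈ y∈ (ℕP.*-cancelʳ-≡ (rank x) (rank y) 2 (ℕP.suc-injective (begin
          suc (rank x * 2) ≡⟨ rank′-old x∈ ⟨
          rank′ x          ≡⟨ eq ⟩
          rank′ y          ≡⟨ rank′-old y∈ ⟩
          suc (rank y * 2) ∎)))
        where open ≡-Reasoning

      extension : tail G e ∈ v ∷ vertices → head G e ∈ v ∷ vertices → e ∉ edges →
                  rank′ (head G e) ≡ suc (rank′ (tail G e)) → Subtree (suc j)
      extension te∈ he∈ e∉ consecutive = record
        { vertices = v ∷ vertices ; edges = e ∷ edges ; rank = rank′ ; root∈ = there root∈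
        ; vertices-unique = ¬Any⇒All¬ vertices v∉ ∷ vertices-unique
        ; edges-unique = ¬Any⇒All¬ edges e∉ ∷ edges-unique
        ; vertices-length = cong suc vertices-length ; edges-length = cong suc edges-length
        ; endpoints∈ = endpoints∈′ ; ascending = ascending′ ; non-crossing = non-crossing′
        ; rank-injective = rank′-injective
        }
        where
        nothing-inside : ∀ x → rank′ (tail G e) < rank′ x → rank′ x < rank′ (head G e) → ⊥
        nothing-inside x te<x x<he = ℕP.<⇒≱ te<x (s≤s⁻¹ (subst (rank′ x <_) consecutive x<he))

        endpoints∈′ : ∀ {f} → f ∈ e ∷ edges → tail G f ∈ v ∷ vertices × head G f ∈ v ∷ vertices
        endpoints∈′ (here refl) = te∈ , he∈
        endpoints∈′ (there f∈) = there (proj₁ (endpoints∈ f∈)) , there (proj₂ (endpoints∈ f∈))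

        ascending′ : ∀ {f} → f ∈ e ∷ edges → rank′ (tail G f) < rank′ (head G f)
        ascending′ (here refl) = subst (rank′ (tail G e) <_) (sym consecutive) (ℕP.n<1+n _)
        ascending′ (there f∈) = rank′-mono (proj₁ (endpoints∈ f∈)) (proj₂ (endpoints∈ f∈)) (ascending f∈)

        non-crossing′ : ∀ {f g} → f ∈ e ∷ edges → g ∈ e ∷ edges → ¬ Interleaved G rank′ f g
        non-crossing′ {f} _ (here refl) (te<tf , tf<he , _) = nothing-inside (tail G f) te<tf tf<he
        non-crossing′ {g = g} (here refl) _ (_ , te<hg , hg<he) = nothing-inside (head G g) te<hg hg<he
        non-crossing′ {f} {g} (there f∈) (there g∈) (tg<tf , tf<hg , hg<hf) =
          non-crossing f∈ g∈
            (rank′-cancel tg∈ tf∈ tg<tf , rank′-cancel tf∈ hg∈ tf<hg , rank′-cancel hg∈ hf∈ hg<hf)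
          where
          tf∈ : tail G f ∈ vertices
          tf∈ = proj₁ (endpoints∈ f∈)
          hf∈ : head G f ∈ vertices
          hf∈ = proj₂ (endpoints∈ f∈)
          tg∈ : tail G g ∈ vertices
          tg∈ = proj₁ (endpoints∈ g∈)
          hg∈ : head G g ∈ vertices
          hg∈ = proj₂ (endpoints∈ g∈)

    module _ {j} (S : Subtree j) where
      open Subtree S

      attach : ∀ e {u v} → u ∈ vertices → v ∉ vertices →
               (tail G e ≡ u × head G e ≡ v) ⊎ (tail G e ≡ v × head G e ≡ u) → Subtree (suc j)
      attach e u∈ v∉ (inj₁ (refl , refl)) =
        extension (there u∈) (here refl) (λ e∈ → v∉ (proj₂ (endpoints∈ e∈)))
          (trans (insertRank-new rank (head G e) _) (cong suc (sym (rank′-old u∈))))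
        where open Attach S e (head G e) v∉ (suc (rank (tail G e)))
      attach e u∈ v∉ (inj₂ (refl , refl)) =
        extension (here refl) (there u∈) (λ e∈ → v∉ (proj₁ (endpoints∈ e∈)))
          (trans (rank′-old u∈) (cong suc (sym (insertRank-new rank (tail G e) _))))
        where open Attach S e (tail G e) v∉ (rank (head G e))

      grow : j < m G → Subtree (suc j)
      grow j<m
        with w , w∉ ← length<⇒∃∉ vertices (subst₂ _<_ (sym vertices-length) suc-m≡n (s≤s j<m))
        with _ , _ , (e , joins) , u∈ , v∉ ← Star-exit (_∈? vertices) (proj₁ tree root w) root∈ w∉
        = attach e u∈ v∉ joins

    subtree : ∀ j → j ≤ m G → Subtree j
    subtree zero    _   = single
    subtree (suc j) j<m = grow (subtree j (ℕP.<⇒≤ j<m)) j<m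

    numbering : NonCrossingNumbering G
    numbering = record
      { rank           = rank
      ; rank-injective = λ {x} {y} → rank-injective (all-vertices x) (all-vertices y)
      ; ascending      = λ e → ascending (all-edges e)
      ; non-crossing   = λ e f → non-crossing (all-edges e) (all-edges f)
      }
      where
      open Subtree (subtree (m G) ℕP.≤-refl)
      all-vertices : ∀ v → v ∈ vertices
      all-vertices = unique∧length≡⇒covering vertices vertices-unique (trans vertices-length suc-m≡n)
      all-edges : ∀ e → e ∈ edges
      all-edges = unique∧length≡⇒covering edges edges-unique edges-length

  directedTree-upwardLeftwardPlanar : (G : Digraph) → IsDirectedTree G →
                                      Σ (LDrawing G) λ D → Upward D × Leftward D × Planar D
  directedTree-upwardLeftwardPlanar G tree =
    diagonal N , diagonal-upward N , diagonal-leftward N , diagonal-planar N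
    where N = TreeNumbering.numbering G tree

module NoUpwardDrawing where

  open import Data.Integer using (_<_)
  open import Data.Integer.Properties using (_<?_)

  ⌊⌋-true : ∀ {p} {P : Set p} (P? : Dec P) → P → ⌊ P? ⌋ ≡ true
  ⌊⌋-true P? p = trans (isYes≗does P?) (dec-true P? p)

  ⌊⌋-false : ∀ {p} {P : Set p} (P? : Dec P) → ¬ P → ⌊ P? ⌋ ≡ false
  ⌊⌋-false P? ¬p = trans (isYes≗does P?) (dec-false P? ¬p)

  variable
    xu yu xv yv xw yw xa ya : ℤ

  outKey-west : yu < yv → xv < xu → outKey xu yu xv yv ≡ key 0 0 yv
  outKey-west {yu} {yv} {xv} {xu} up west rewrite ⌊⌋-true (yu <? yv) up | ⌊⌋-true (xv <? xu) west = refl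

  outKey-east : yu < yv → ¬ xv < xu → outKey xu yu xv yv ≡ key 0 1 (- yv)
  outKey-east {yu} {yv} {xv} {xu} up east rewrite ⌊⌋-true (yu <? yv) up | ⌊⌋-false (xv <? xu) east = refl

  inKey-east : yu < yv → xv < xu → inKey xv yv xu yu ≡ key 1 1 (- xu)
  inKey-east {yu} {yv} {xv} {xu} up east
    rewrite ⌊⌋-true (xv <? xu) east | ⌊⌋-false (yv <? yu) (ℤP.<-asym up) = refl

  inKey-west : yu < yv → ¬ xv < xu → inKey xv yv xu yu ≡ key 3 0 (- xu)
  inKey-west {yu} {yv} {xv} {xu} up west rewrite ⌊⌋-false (xv <? xu) west | ⌊⌋-true (yu <? yv) up = refl

  out<out-west : yu < yv → yu < yw → xw < xu → outKey xu yu xv yv <K outKey xu yu xw yw → yv < yw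
  out<out-west {yv = yv} {yw = yw} {xu = xu} {xv = xv} v-up w-up w-west lt = by-side (xv <? xu)
    where
    by-side : Dec (xv < xu) → yv < yw
    by-side (yes v-west) with subst₂ _<K_ (outKey-west v-up v-west) (outKey-west w-up w-west) lt
    ... | val< yv<yw = yv<yw
    by-side (no v-east) with subst₂ _<K_ (outKey-east v-up v-east) (outKey-west w-up w-west) lt
    ... | sub< ()

  out<out-east : yu < yv → yu < yw → ¬ xv < xu → outKey xu yu xv yv <K outKey xu yu xw yw →
                 ¬ xw < xu × yw < yv
  out<out-east {yv = yv} {yw = yw} {xu = xu} {xw = xw} v-up w-up v-east lt = by-side (xw <? xu)
    where
    by-side : Dec (xw < xu) → ¬ xw < xu × yw < yv
    by-side (yes w-west) with subst₂ _<K_ (outKey-east v-up v-east) (outKey-west w-up w-west) lt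
    ... | sub< ()
    by-side (no w-east) with subst₂ _<K_ (outKey-east v-up v-east) (outKey-east w-up w-east) lt
    ... | val< -yv<-yw = w-east , ℤP.neg-cancel-< -yv<-yw
    ... | sub< (s≤s ())

  in<in-east : yu < yv → ya < yv → xv < xu → inKey xv yv xa ya <K inKey xv yv xu yu → xu < xa
  in<in-east {xv = xv} {xu = xu} {xa = xa} u-up a-up u-east lt = by-side (xv <? xa)
    where
    by-side : Dec (xv < xa) → xu < xa
    by-side (yes a-east) with subst₂ _<K_ (inKey-east a-up a-east) (inKey-east u-up u-east) lt
    ... | val< -xa<-xu = ℤP.neg-cancel-< -xa<-xu
    ... | port< (s≤s ())
    ... | sub< (s≤s ())
    by-side (no a-west) with subst₂ _<K_ (inKey-west a-up a-west) (inKey-east u-up u-east) lt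
    ... | port< (s≤s ())

  in<in-west : yu < yv → ya < yv → ¬ xv < xu → inKey xv yv xu yu <K inKey xv yv xa ya → xa < xu
  in<in-west {xv = xv} {xu = xu} {xa = xa} u-up a-up u-west lt = by-side (xv <? xa)
    where
    by-side : Dec (xv < xa) → xa < xu
    by-side (yes a-east) with subst₂ _<K_ (inKey-west u-up u-west) (inKey-east a-up a-east) lt
    ... | port< (s≤s ())
    by-side (no a-west) with subst₂ _<K_ (inKey-west u-up u-west) (inKey-west a-up a-west) lt
    ... | val< -xu<-xa = ℤP.neg-cancel-< -xu<-xa
    ... | port< (s≤s (s≤s (s≤s ())))

  in≮out : yu < yv → yv < yw → ¬ inKey xv yv xu yu <K outKey xv yv xw yw
  in≮out {xv = xv} {xu = xu} {xw = xw} u-up up lt = by-sides (xv <? xu) (xw <? xv)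
    where
    by-sides : Dec (xv < xu) → Dec (xw < xv) → ⊥
    by-sides (yes east) (yes west) with subst₂ _<K_ (inKey-east u-up east) (outKey-west up west) lt
    ... | port< ()
    by-sides (yes east) (no ¬west) with subst₂ _<K_ (inKey-east u-up east) (outKey-east up ¬west) lt
    ... | port< ()
    by-sides (no ¬east) (yes west) with subst₂ _<K_ (inKey-west u-up ¬east) (outKey-west up west) lt
    ... | port< ()
    by-sides (no ¬east) (no ¬west) with subst₂ _<K_ (inKey-west u-up ¬east) (outKey-east up ¬west) lt
    ... | port< ()

  linked-cyclic₃ : ∀ {A B : Set} {R : B → B → Set} {f : A → B} {a b c : A} {l : List A} →
                   CyclicShift (a ∷ b ∷ c ∷ []) l → Linked R (map f l) →
                   ¬ R (f a) (f b) ⊎ ¬ R (f c) (f a) → R (f b) (f c)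
  linked-cyclic₃ ([]                , _ , refl , refl) (_ ∷ bc ∷ _)  _ = bc
  linked-cyclic₃ (_ ∷ []            , _ , refl , refl) (bc ∷ _)      _ = bc
  linked-cyclic₃ (_ ∷ _ ∷ []        , _ , refl , refl) (ca ∷ ab ∷ _) h = ⊥-elim ([ _$ ab , _$ ca ] h)
  linked-cyclic₃ (_ ∷ _ ∷ _ ∷ []    , _ , refl , refl) (_ ∷ bc ∷ _)  _ = bc
  linked-cyclic₃ (_ ∷ _ ∷ _ ∷ _ ∷ _ , _ , ()   , _)

  Adj-forward : ∀ {G} e → Adj G (tail G e) (head G e)
  Adj-forward e = e , inj₁ (refl , refl)

  Adj-backward : ∀ {G} e → Adj G (head G e) (tail G e)
  Adj-backward e = e , inj₂ (refl , refl)

  Adj-sym : ∀ {G x y} → Adj G x y → Adj G y x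
  Adj-sym (e , inj₁ ends) = e , inj₂ ends
  Adj-sym (e , inj₂ ends) = e , inj₁ ends

  ≮∧≢⇒> : ∀ {i j : ℤ} → ¬ i < j → i ≢ j → j < i
  ≮∧≢⇒> i≮j i≢j = ℤP.≤∧≢⇒< (ℤP.≮⇒≥ i≮j) (≢-sym i≢j)

  module _ {G : Digraph} (D : LDrawing G) where

    keyAt-out : ∀ {v} f → tail G f ≡ v →
                keyAt D v f ≡ outKey (x D v) (y D v) (x D (head G f)) (y D (head G f))
    keyAt-out {v} f tf≡v rewrite ⌊⌋-true (tail G f ≟ v) tf≡v = refl

    keyAt-in : Upward D → ∀ e →
               keyAt D (head G e) e ≡ inKey (x D (head G e)) (y D (head G e)) (x D (tail G e)) (y D (tail G e))
    keyAt-in up e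
      rewrite ⌊⌋-false (tail G e ≟ head G e) (λ te≡he → ℤP.<-irrefl (cong (y D) te≡he) (up e)) = refl

    in≮out-at : Upward D → ∀ e f → head G e ≡ tail G f → ¬ keyAt D (head G e) e <K keyAt D (head G e) f
    in≮out-at up e f he≡tf lt =
      in≮out {xv = x D (head G e)} {xu = x D (tail G e)} {xw = x D (head G f)}
        (up e) (subst (λ t → y D t < y D (head G f)) (sym he≡tf) (up f))
        (subst₂ _<K_ (keyAt-in up e) (keyAt-out f (sym he≡tf)) lt)

  _⇔-dec_ : ∀ {p q} {P : Set p} {Q : Set q} → Dec P → Dec Q → Dec (P ⇔ Q)
  P? ⇔-dec Q? = map′ (λ (to , from) → mk⇔ to from) (λ P⇔Q → Equivalence.to P⇔Q , Equivalence.from P⇔Q)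
                     ((P? →-dec Q?) ×-dec (Q? →-dec P?))

  module Counterexample where

    open DecMembership (_≟_ {7}) using (_∈?_)
    open DecUnique (_≟_ {7}) using (unique?)

    pattern u = F.zero
    pattern s = F.suc u
    pattern v = F.suc s
    pattern z = F.suc v
    pattern a = F.suc z
    pattern w = F.suc a
    pattern r = F.suc w
    pattern c = F.suc r

    pattern su = F.zero
    pattern uv = F.suc su
    pattern uw = F.suc uv
    pattern vz = F.suc uw
    pattern av = F.suc vz
    pattern wr = F.suc av
    pattern cw = F.suc wr

    tl : Fin 7 → Fin 8
    tl su = s
    tl uv = u
    tl uw = u
    tl vz = v
    tl av = a
    tl wr = w
    tl cw = c

    hd : Fin 7 → Fin 8
    hd su = u
    hd uv = v
    hd uw = w
    hd vz = z
    hd av = v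
    hd wr = r
    hd cw = w

    T : Digraph
    T = record { n = 8 ; m = 7 ; tail = tl ; head = hd }

    path-to-u : ∀ x → Star (Adj T) x u
    path-to-u u = ε
    path-to-u s = Adj-forward su ◅ ε
    path-to-u v = Adj-backward uv ◅ ε
    path-to-u z = Adj-backward vz ◅ Adj-backward uv ◅ ε
    path-to-u a = Adj-forward av ◅ Adj-backward uv ◅ ε
    path-to-u w = Adj-backward uw ◅ ε
    path-to-u r = Adj-backward wr ◅ Adj-backward uw ◅ ε
    path-to-u c = Adj-forward cw ◅ Adj-backward uw ◅ ε

    T-tree : IsDirectedTree T
    T-tree = (λ x y → path-to-u x ◅◅ Star.reverse Adj-sym (path-to-u y)) , refl

    rot : Rotation T
    rot u = su ∷ uv ∷ uw ∷ []
    rot s = su ∷ []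
    rot v = vz ∷ av ∷ uv ∷ []
    rot z = vz ∷ []
    rot a = av ∷ []
    rot w = wr ∷ uw ∷ cw ∷ []
    rot r = wr ∷ []
    rot c = cw ∷ []

    incident? : ∀ x e → Dec (Incident T x e)
    incident? x e = (tl e ≟ x) ⊎-dec (hd e ≟ x)

    T-embedding : IsEmbedding T rot
    T-embedding =
      toWitness {a? = FP.all? λ x → unique? (rot x) ×-dec FP.all? λ e → (e ∈? rot x) ⇔-dec incident? x e} _

    T-bimodal : IsBimodal T rot
    T-bimodal u = su ∷ [] , uv ∷ uw ∷ [] , ([] , _ , refl , refl) , refl ∷ [] , refl ∷ refl ∷ []
    T-bimodal s = [] , su ∷ [] , ([] , _ , refl , refl) , [] , refl ∷ []
    T-bimodal v = av ∷ uv ∷ [] , vz ∷ [] , (vz ∷ [] , _ , refl , refl) , refl ∷ refl ∷ [] , refl ∷ []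
    T-bimodal z = vz ∷ [] , [] , ([] , _ , refl , refl) , refl ∷ [] , []
    T-bimodal a = [] , av ∷ [] , ([] , _ , refl , refl) , [] , refl ∷ []
    T-bimodal w = uw ∷ cw ∷ [] , wr ∷ [] , (wr ∷ [] , _ , refl , refl) , refl ∷ refl ∷ [] , refl ∷ []
    T-bimodal r = wr ∷ [] , [] , ([] , _ , refl , refl) , refl ∷ [] , []
    T-bimodal c = [] , cw ∷ [] , ([] , _ , refl , refl) , [] , refl ∷ []

    module _ (D : LDrawing T) (upward : Upward D) (planar : Planar D) (respects : Respects D rot) where
      X Y : Fin 8 → ℤ
      X = x D
      Y = y D

      middle-pair : ∀ x {e₁ e₂ e₃} → rot x ≡ e₁ ∷ e₂ ∷ e₃ ∷ [] →
                    ¬ keyAt D x e₁ <K keyAt D x e₂ ⊎ ¬ keyAt D x e₃ <K keyAt D x e₁ →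
                    keyAt D x e₂ <K keyAt D x e₃
      middle-pair x rot-x h with _ , shift , linked ← respects x rewrite rot-x =
        linked-cyclic₃ shift linked h

      uv-before-uw : outKey (X u) (Y u) (X v) (Y v) <K outKey (X u) (Y u) (X w) (Y w)
      uv-before-uw = middle-pair u refl (inj₁ (in≮out-at D upward su uv refl))

      av-before-uv : inKey (X v) (Y v) (X a) (Y a) <K inKey (X v) (Y v) (X u) (Y u)
      av-before-uv = middle-pair v refl (inj₂ (in≮out-at D upward uv vz refl))

      uw-before-cw : inKey (X w) (Y w) (X u) (Y u) <K inKey (X w) (Y w) (X c) (Y c)
      uw-before-cw = middle-pair w refl (inj₂ (in≮out-at D upward cw wr refl))

      x-distinct : ∀ {p q} → p ≢ q → X p ≢ X q
      x-distinct p≢q = p≢q ∘ x-inj D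

      y-distinct : ∀ {p q} → p ≢ q → Y p ≢ Y q
      y-distinct p≢q = p≢q ∘ y-inj D

      w-east-of-u-below-v : ¬ X w < X u × Y w < Y v
      w-east-of-u-below-v with X v <? X u
      ... | no v-east = out<out-east {xw = X w} (upward uv) (upward uw) v-east uv-before-uw
      ... | yes v-west = w-east , w-below
        where
        a-east : X u < X a
        a-east = in<in-east {xa = X a} (upward uv) (upward av) v-west av-before-uv
        v-not-below-w : ¬ Y v < Y w
        v-not-below-w v<w = planar uw av (inj₂ (v-west , a-east) , inj₁ (upward uv , v<w))
        w-below : Y w < Y v
        w-below = ≮∧≢⇒> v-not-below-w (y-distinct λ ())
        w-east : ¬ X w < X u
        w-east w-west = v-not-below-w (out<out-west {xv = X v} (upward uv) (upward uw) w-west uv-before-uw)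

      no-respecting-drawing : ⊥
      no-respecting-drawing = planar uv cw (inj₁ (c-west , u-west-of-w) , inj₁ (upward uw , w-below))
        where
        w-east : ¬ X w < X u
        w-east = proj₁ w-east-of-u-below-v
        w-below : Y w < Y v
        w-below = proj₂ w-east-of-u-below-v
        c-west : X c < X u
        c-west = in<in-west {xa = X c} (upward uw) (upward cw) w-east uw-before-cw
        u-west-of-w : X u < X w
        u-west-of-w = ≮∧≢⇒> w-east (x-distinct λ ())

theorem3 : ((G : Digraph) → IsDirectedTree G →
             Σ (LDrawing G) λ D → Upward D × Leftward D × Planar D)
           ×
           (Σ Digraph λ G → IsDirectedTree G ×
             Σ (Rotation G) λ rot → IsEmbedding G rot × IsBimodal G rot ×
               ((D : LDrawing G) → Upward D → Planar D → ¬ Respects D rot))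
theorem3 =
  UpwardLeftward.directedTree-upwardLeftwardPlanar ,
  (T , T-tree , rot , T-embedding , T-bimodal , no-respecting-drawing)
  where open NoUpwardDrawing.Counterexample
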